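{- For every $n\ge1$ and any input sequence $s\in\{0,1\}^{\ell}$ with $0\le\ell\le n$, there exists an adaptive algorithm that exactly recovers $s$ using at most $n+2$ queries, each query being a sequence over $\{0,1\}$ of length at most $n$ (no extra characters), where each query $q$ returns the exact Levenshtein distance $d_L(s,q)$.
   Context: The Levenshtein (edit) distance $d_L(x,y)$ is the minimal number of single-symbol insertions, deletions and substitutions transforming $x$ into $y$. Query model: $s$ is unknown (its length is also unknown); the algorithm chooses query sequences $q$, possibly depending on previous answers (adaptive), and receives $d_L(s,q)$. -}

module Defs where

open import Data.Nat using (ℕ; zero; suc; _+_; _≤_; _⊓_)
open import Data.Bool using (Bool; true; false; if_then_else_)
open import Data.Bool.Properties using () renaming (_≟_ to _≟ᵇ_)
open import Data.List using (List; []; _∷_; length)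
open import Data.Product using (_×_)
open import Relation.Nullary using (does)
open import Relation.Binary.PropositionalEquality using (_≡_)

-- Levenshtein distance over the binary alphabet {0,1} (= Bool), given by the
-- standard Wagner–Fischer recurrence, which characterises the minimal number
-- of single-symbol insertions, deletions and substitutions.
levenshtein : List Bool → List Bool → ℕ
levenshtein [] ys = length ys
levenshtein (x ∷ xs) [] = suc (length xs)
levenshtein (x ∷ xs) (y ∷ ys) =
  (suc (levenshtein xs (y ∷ ys)) ⊓ suc (levenshtein (x ∷ xs) ys))
    ⊓ ((if does (x ≟ᵇ y) then 0 else 1) + levenshtein xs ys)

-- An adaptive query algorithm making at most k queries: a decision tree.
-- 'ask q next' queries the binary sequence q and continues with 'next a'
-- where a is the answer d_L(s,q); 'done o' stops and outputs o.
data Strategy : ℕ → Set where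
  done : {k : ℕ} → List Bool → Strategy k
  ask  : {k : ℕ} → List Bool → (ℕ → Strategy k) → Strategy (suc k)

Recovers : {k : ℕ} → ℕ → List Bool → Strategy k → Set
Recovers n s (done o) = o ≡ s
Recovers n s (ask q next) = length q ≤ n × Recovers n s (next (levenshtein s q))

{-# OPTIONS --safe #-}
module Submission where

-- First ask the empty word, whose distance to s is its length ℓ, then 0^ℓ, whose
-- distance to s is its number o of ones.  Knowing a prefix p of s and the number o
-- of ones in the rest x ∷ r, ask p ++ 1 0^|r|.  The common prefix cancels, and the
-- answer is o - 1 if x = 1 (the Hamming distance is optimal), while if x = 0 it is
-- at least o, because every edit changes the number of ones or of zeros by at most
-- one.  So each further query reveals one symbol: ℓ + 2 queries in total.

open import Defs
open import Data.Nat using (ℕ; zero; suc; pred; _+_; _⊓_; _≤_; _<_; _<?_; z≤n; s≤s)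
open import Data.Nat.Properties
open import Data.Bool using (Bool; true; false; if_then_else_)
open import Data.Bool.Properties using () renaming (_≟_ to _≟ᵇ_)
open import Data.List using (List; []; _∷_; _++_; _∷ʳ_; length; replicate)
open import Data.List.Properties using (length-++; length-replicate; ∷ʳ-++; ++-identityʳ)
open import Data.Product using (Σ; _,_)
open import Relation.Nullary using (does)
open import Relation.Nullary.Decidable using (dec-true; dec-false)
open import Relation.Binary.PropositionalEquality
open import Algebra.Properties.CommutativeSemigroup +-commutativeSemigroup using (interchange)

mismatch : Bool → Bool → ℕ
mismatch x y = if does (x ≟ᵇ y) then 0 else 1

mismatch-refl : ∀ x → mismatch x x ≡ 0
mismatch-refl true = refl
mismatch-refl false = refl

mismatch-comm : ∀ x y → mismatch x y ≡ mismatch y x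
mismatch-comm true true = refl
mismatch-comm true false = refl
mismatch-comm false true = refl
mismatch-comm false false = refl

levenshtein-[]ʳ : ∀ xs → levenshtein xs [] ≡ length xs
levenshtein-[]ʳ [] = refl
levenshtein-[]ʳ (x ∷ xs) = refl

levenshtein-comm : ∀ xs ys → levenshtein xs ys ≡ levenshtein ys xs
levenshtein-comm [] [] = refl
levenshtein-comm [] (y ∷ ys) = refl
levenshtein-comm (x ∷ xs) [] = refl
levenshtein-comm (x ∷ xs) (y ∷ ys) = cong₂ _⊓_
  (trans (cong₂ _⊓_ (cong suc (levenshtein-comm xs (y ∷ ys)))
                    (cong suc (levenshtein-comm (x ∷ xs) ys)))
         (⊓-comm _ _))
  (cong₂ _+_ (mismatch-comm x y) (levenshtein-comm xs ys))

levenshtein-∷ˡ-≤ : ∀ x xs ys → levenshtein (x ∷ xs) ys ≤ suc (levenshtein xs ys)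
levenshtein-∷ˡ-≤ x xs [] = ≤-reflexive (cong suc (sym (levenshtein-[]ʳ xs)))
levenshtein-∷ˡ-≤ x xs (y ∷ ys) = ≤-trans (m⊓n≤m _ _) (m⊓n≤m _ _)

levenshtein-≤-∷ʳ : ∀ xs y ys → levenshtein xs ys ≤ suc (levenshtein xs (y ∷ ys))
levenshtein-≤-∷ʳ [] y ys = ≤-trans (n≤1+n _) (n≤1+n _)
levenshtein-≤-∷ʳ (x ∷ xs) y ys = ⊓-glb (⊓-glb
  (≤-trans (levenshtein-∷ˡ-≤ x xs ys) (s≤s (levenshtein-≤-∷ʳ xs y ys)))
  (≤-trans (n≤1+n _) (n≤1+n _)))
  (≤-trans (levenshtein-∷ˡ-≤ x xs ys) (s≤s (m≤n+m _ _)))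

levenshtein-≤-∷ˡ : ∀ x xs ys → levenshtein xs ys ≤ suc (levenshtein (x ∷ xs) ys)
levenshtein-≤-∷ˡ x xs ys = subst₂ (λ a b → a ≤ suc b)
  (levenshtein-comm ys xs) (levenshtein-comm ys (x ∷ xs)) (levenshtein-≤-∷ʳ ys x xs)

levenshtein-∷-cancel : ∀ x xs ys → levenshtein (x ∷ xs) (x ∷ ys) ≡ levenshtein xs ys
levenshtein-∷-cancel x xs ys = ≤-antisym
  (≤-trans (m⊓n≤n _ _) (≤-reflexive head-matches))
  (⊓-glb (⊓-glb (levenshtein-≤-∷ʳ xs x ys) (levenshtein-≤-∷ˡ x xs ys))
         (≤-reflexive (sym head-matches)))
  where
  head-matches : mismatch x x + levenshtein xs ys ≡ levenshtein xs ys
  head-matches = cong (_+ levenshtein xs ys) (mismatch-refl x)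

levenshtein-++-cancel : ∀ ps xs ys → levenshtein (ps ++ xs) (ps ++ ys) ≡ levenshtein xs ys
levenshtein-++-cancel [] xs ys = refl
levenshtein-++-cancel (p ∷ ps) xs ys =
  trans (levenshtein-∷-cancel p (ps ++ xs) (ps ++ ys)) (levenshtein-++-cancel ps xs ys)

occurs : Bool → Bool → ℕ
occurs c x = if does (c ≟ᵇ x) then 1 else 0

count : Bool → List Bool → ℕ
count c [] = 0
count c (x ∷ xs) = occurs c x + count c xs

occurs≤1 : ∀ c x → occurs c x ≤ 1
occurs≤1 true true = ≤-refl
occurs≤1 true false = z≤n
occurs≤1 false true = z≤n
occurs≤1 false false = ≤-refl

occurs-≤-mismatch : ∀ c x y → occurs c x ≤ mismatch x y + occurs c y
occurs-≤-mismatch c true true = ≤-refl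
occurs-≤-mismatch c false false = ≤-refl
occurs-≤-mismatch c true false = ≤-trans (occurs≤1 c true) (m≤m+n 1 _)
occurs-≤-mismatch c false true = ≤-trans (occurs≤1 c false) (m≤m+n 1 _)

count-≤-length : ∀ c xs → count c xs ≤ length xs
count-≤-length c [] = z≤n
count-≤-length c (x ∷ xs) = +-mono-≤ (occurs≤1 c x) (count-≤-length c xs)

count-∷-≤ : ∀ c x xs → count c (x ∷ xs) ≤ suc (count c xs)
count-∷-≤ c x xs = +-monoˡ-≤ (count c xs) (occurs≤1 c x)

count-true+count-false : ∀ xs → count true xs + count false xs ≡ length xs
count-true+count-false [] = refl
count-true+count-false (true ∷ xs) = cong suc (count-true+count-false xs)
count-true+count-false (false ∷ xs) =
  trans (+-suc (count true xs) (count false xs)) (cong suc (count-true+count-false xs))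

⊓-glb-+ʳ : ∀ {t} u v k → t ≤ u + k → t ≤ v + k → t ≤ (u ⊓ v) + k
⊓-glb-+ʳ {t} u v k p q = subst (t ≤_) (sym (+-distribʳ-⊓ k u v)) (⊓-glb p q)

count-≤-levenshtein-∷ : ∀ c x xs y ys →
  count c xs ≤ levenshtein xs (y ∷ ys) + count c (y ∷ ys) →
  count c (x ∷ xs) ≤ levenshtein (x ∷ xs) ys + count c ys →
  count c xs ≤ levenshtein xs ys + count c ys →
  count c (x ∷ xs) ≤ levenshtein (x ∷ xs) (y ∷ ys) + count c (y ∷ ys)
count-≤-levenshtein-∷ c x xs y ys after-delete after-insert after-substitute =
  ⊓-glb-+ʳ (suc deleted ⊓ suc inserted) (mismatch x y + levenshtein xs ys) (count c (y ∷ ys))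
    (⊓-glb-+ʳ (suc deleted) (suc inserted) _ delete insert)
    substitute
  where
  open ≤-Reasoning
  deleted inserted : ℕ
  deleted = levenshtein xs (y ∷ ys)
  inserted = levenshtein (x ∷ xs) ys
  delete : count c (x ∷ xs) ≤ suc deleted + count c (y ∷ ys)
  delete = ≤-trans (count-∷-≤ c x xs) (s≤s after-delete)
  insert : count c (x ∷ xs) ≤ suc inserted + count c (y ∷ ys)
  insert = ≤-trans after-insert (+-mono-≤ (n≤1+n _) (m≤n+m (count c ys) (occurs c y)))
  substitute : count c (x ∷ xs) ≤ (mismatch x y + levenshtein xs ys) + count c (y ∷ ys)
  substitute = begin
    occurs c x + count c xs
      ≤⟨ +-mono-≤ (occurs-≤-mismatch c x y) after-substitute ⟩
    (mismatch x y + occurs c y) + (levenshtein xs ys + count c ys)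
      ≡⟨ interchange (mismatch x y) (occurs c y) (levenshtein xs ys) (count c ys) ⟩
    (mismatch x y + levenshtein xs ys) + (occurs c y + count c ys) ∎

count-≤-levenshtein : ∀ c xs ys → count c xs ≤ levenshtein xs ys + count c ys
count-≤-levenshtein c [] ys = z≤n
count-≤-levenshtein c (x ∷ xs) [] = ≤-trans (count-≤-length c (x ∷ xs)) (m≤m+n _ _)
count-≤-levenshtein c (x ∷ xs) (y ∷ ys) = count-≤-levenshtein-∷ c x xs y ys
  (count-≤-levenshtein c xs (y ∷ ys))
  (count-≤-levenshtein c (x ∷ xs) ys)
  (count-≤-levenshtein c xs ys)

count-≤-levenshtein′ : ∀ c xs ys → count c ys ≤ levenshtein xs ys + count c xs
count-≤-levenshtein′ c xs ys =
  subst (λ d → count c ys ≤ d + count c xs) (levenshtein-comm ys xs) (count-≤-levenshtein c ys xs)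

zeros : ℕ → List Bool
zeros k = replicate k false

count-true-zeros : ∀ k → count true (zeros k) ≡ 0
count-true-zeros zero = refl
count-true-zeros (suc k) = count-true-zeros k

count-false-zeros : ∀ k → count false (zeros k) ≡ k
count-false-zeros zero = refl
count-false-zeros (suc k) = cong suc (count-false-zeros k)

count-true-≤-levenshtein-zeros : ∀ xs k → count true xs ≤ levenshtein xs (zeros k)
count-true-≤-levenshtein-zeros xs k = subst (count true xs ≤_)
  (trans (cong (levenshtein xs (zeros k) +_) (count-true-zeros k)) (+-identityʳ _))
  (count-≤-levenshtein true xs (zeros k))

levenshtein-zeros-≤-count-true : ∀ xs → levenshtein xs (zeros (length xs)) ≤ count true xs
levenshtein-zeros-≤-count-true [] = z≤n
levenshtein-zeros-≤-count-true (true ∷ xs) = ≤-trans (m⊓n≤n _ _) (s≤s (levenshtein-zeros-≤-count-true xs))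
levenshtein-zeros-≤-count-true (false ∷ xs) = ≤-trans (m⊓n≤n _ _) (levenshtein-zeros-≤-count-true xs)

levenshtein-zeros : ∀ xs → levenshtein xs (zeros (length xs)) ≡ count true xs
levenshtein-zeros xs =
  ≤-antisym (levenshtein-zeros-≤-count-true xs) (count-true-≤-levenshtein-zeros xs (length xs))

probe : ℕ → List Bool
probe k = true ∷ zeros k

levenshtein-probe-true : ∀ xs → levenshtein (true ∷ xs) (probe (length xs)) ≡ count true xs
levenshtein-probe-true xs = trans (levenshtein-∷-cancel true xs (zeros (length xs))) (levenshtein-zeros xs)

count-true-<-levenshtein-probe-false : ∀ xs → count true xs < levenshtein (false ∷ xs) (probe (length xs))
count-true-<-levenshtein-probe-false xs = ⊓-glb (⊓-glb
  (s≤s count-true-≤-levenshtein-probe)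
  (s≤s (count-true-≤-levenshtein-zeros (false ∷ xs) (length xs))))
  (s≤s (count-true-≤-levenshtein-zeros xs (length xs)))
  where
  open ≤-Reasoning
  count-true-≤-levenshtein-probe : count true xs ≤ levenshtein xs (probe (length xs))
  count-true-≤-levenshtein-probe = +-cancelʳ-≤ (count false xs) _ _ (begin
    count true xs + count false xs       ≡⟨ count-true+count-false xs ⟩
    length xs                            ≡⟨ count-false-zeros (length xs) ⟨
    count false (probe (length xs))      ≤⟨ count-≤-levenshtein′ false xs (probe (length xs)) ⟩
    levenshtein xs (probe (length xs)) + count false xs ∎)

-- The fuel bounds the depth uniformly, as the length is only learnt from the first answer.
decode : (fuel : ℕ) → List Bool → ℕ → ℕ → Strategy fuel
decode fuel p zero ones = done p
decode zero p (suc k) ones = done p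
decode (suc fuel) p (suc k) ones = ask (p ++ probe k) λ answer →
  if does (answer <? ones)
    then decode fuel (p ∷ʳ true) k (pred ones)
    else decode fuel (p ∷ʳ false) k ones

length-++-probe : ∀ p x xs → length (p ++ probe (length xs)) ≡ length (p ++ x ∷ xs)
length-++-probe p x xs = begin
  length (p ++ probe (length xs))       ≡⟨ length-++ p ⟩
  length p + suc (length (zeros (length xs)))
    ≡⟨ cong (λ m → length p + suc m) (length-replicate (length xs)) ⟩
  length p + length (x ∷ xs)            ≡⟨ length-++ p ⟨
  length (p ++ x ∷ xs)                  ∎
  where open ≡-Reasoning

decode-recovers : ∀ {n s} fuel p r → length s ≤ n → length r ≤ fuel → p ++ r ≡ s →
  Recovers n s (decode fuel p (length r) (count true r))
decode-recovers fuel p [] s≤n r≤fuel refl = sym (++-identityʳ p)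
decode-recovers (suc fuel) p (true ∷ r) s≤n (s≤s r≤fuel) refl
  rewrite levenshtein-++-cancel p (true ∷ r) (probe (length r))
        | dec-true (_ <? suc (count true r)) (s≤s (≤-reflexive (levenshtein-probe-true r)))
  = ≤-trans (≤-reflexive (length-++-probe p true r)) s≤n
  , decode-recovers fuel (p ∷ʳ true) r s≤n r≤fuel (∷ʳ-++ p true r)
decode-recovers (suc fuel) p (false ∷ r) s≤n (s≤s r≤fuel) refl
  rewrite levenshtein-++-cancel p (false ∷ r) (probe (length r))
        | dec-false (_ <? count true r) (<⇒≯ (count-true-<-levenshtein-probe-false r))
  = ≤-trans (≤-reflexive (length-++-probe p false r)) s≤n
  , decode-recovers fuel (p ∷ʳ false) r s≤n r≤fuel (∷ʳ-++ p false r)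

recover : (n : ℕ) → Strategy (suc (suc n))
recover n = ask [] λ ℓ → ask (zeros ℓ) λ ones → decode n [] ℓ ones

recover-recovers : ∀ n s → length s ≤ n → Recovers n s (recover n)
recover-recovers n s s≤n rewrite levenshtein-[]ʳ s | levenshtein-zeros s
  = z≤n
  , ≤-trans (≤-reflexive (length-replicate (length s))) s≤n
  , decode-recovers n [] s s≤n s≤n refl

Recovers-subst : ∀ {k m n s} (k≡m : k ≡ m) (t : Strategy k) →
  Recovers n s t → Recovers n s (subst Strategy k≡m t)
Recovers-subst refl t recovers = recovers

mainTheorem3 : (n : ℕ) → 1 ≤ n →
    Σ (Strategy (n + 2)) (λ t → (s : List Bool) → length s ≤ n → Recovers n s t)
mainTheorem3 n _ =
  subst Strategy (+-comm 2 n) (recover n) ,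
  λ s s≤n → Recovers-subst (+-comm 2 n) (recover n) (recover-recovers n s s≤n)
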